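{- A permutation $\sigma\in\mathfrak S_n$ belongs to $\mathcal R_n$ if and only if the tree $T(\sigma)$ has no node whose only child is a left child.
   Context: $\mathcal R_n$ is the set of $\sigma\in\mathfrak S_n$ with no $i$ such that $\sigma_i>\sigma_{i+1}>\sigma_{i+2}$ and with $\sigma_{n-1}<\sigma_n$ (no descent at the end). For a word $w$ with distinct letters from $[n]$, the min-tree $T(w)$ is the increasing planar binary tree (left and right children distinguished) defined recursively: the empty word gives the empty tree; otherwise, with $m$ the smallest letter and $w=w_1\,m\,w_2$, the root is labeled $m$, its left subtree is $T(w_1)$ and its right subtree is $T(w_2)$. -}

module Defs where

open import Data.Nat using (ℕ; zero; suc; _<_; _>_; _⊓_; _≡ᵇ_)
open import Data.List using (List; []; _∷_; _++_; [_]; length; foldr; map; upTo)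
open import Data.Product using (_×_; _,_; ∃-syntax)
open import Data.Bool using (if_then_else_)
open import Relation.Nullary using (¬_)
open import Relation.Binary.PropositionalEquality using (_≡_; _≢_)
open import Data.List.Relation.Binary.Permutation.Propositional using (_↭_)

-- σ ∈ 𝔖ₙ, written in one-line notation σ₁ σ₂ … σₙ as a list of its values:
-- a rearrangement of 1, 2, …, n.
IsPerm : ℕ → List ℕ → Set
IsPerm n σ = σ ↭ map suc (upTo n)

NoDoubleDescent : List ℕ → Set
NoDoubleDescent σ =
  ¬ (∃[ u ] ∃[ x ] ∃[ y ] ∃[ z ] ∃[ v ] (σ ≡ u ++ x ∷ y ∷ z ∷ v × x > y × y > z))

-- σₙ₋₁ < σₙ (no descent at the end); vacuous when n < 2
NoFinalDescent : List ℕ → Set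
NoFinalDescent σ = ∀ u x y → σ ≡ u ++ x ∷ y ∷ [] → x < y

InR : ℕ → List ℕ → Set
InR n σ = IsPerm n σ × NoDoubleDescent σ × NoFinalDescent σ

data Tree : Set where
  empty : Tree
  node  : Tree → ℕ → Tree → Tree

minLetter : ℕ → List ℕ → ℕ
minLetter x xs = foldr _⊓_ x xs

splitAt : ℕ → List ℕ → List ℕ × List ℕ
splitAt m [] = [] , []
splitAt m (x ∷ xs) with splitAt m xs
... | (l , r) = if x ≡ᵇ m then ([] , xs) else (x ∷ l , r)

-- min-tree with fuel (fuel = length of the word suffices, since w₁, w₂ are shorter)
minTreeFuel : ℕ → List ℕ → Tree
minTreeFuel zero _ = empty
minTreeFuel (suc k) [] = empty
minTreeFuel (suc k) (x ∷ xs) with splitAt (minLetter x xs) (x ∷ xs)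
... | (w₁ , w₂) = node (minTreeFuel k w₁) (minLetter x xs) (minTreeFuel k w₂)

T : List ℕ → Tree
T w = minTreeFuel (length w) w

data NoOnlyLeftChild : Tree → Set where
  empty : NoOnlyLeftChild empty
  node  : ∀ {l m r} → ¬ (l ≢ empty × r ≡ empty) →
          NoOnlyLeftChild l → NoOnlyLeftChild r → NoOnlyLeftChild (node l m r)

module Submission where

-- Both sides of the equivalence are recast as one local condition on words,
-- `Resolved`: every descent bottom (a letter smaller than its predecessor) is
-- immediately followed by a letter at least as large; in particular no descent
-- is final.
--
-- 1. For words with distinct letters, such as permutations, `Resolved` is
--    exactly "no double descent and no final descent" (`inR⇔resolved`).
-- 2. If m is below every letter of l and of r, then the word l m r is resolved
--    iff l and r are, and not (l ≠ [] and r = []) (`resolved-split`): the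
--    descent into m must be resolved by r, and m never causes a descent in r.
-- 3. The min-tree of w is read off the splitting w = w₁ m w₂ at the minimum m,
--    so by induction `NoOnlyLeftChild (T w) ⇔ Resolved w` (`minTree-resolved`):
--    the root condition of `NoOnlyLeftChild` is the side condition of step 2.
-- The proposition is the composition of steps 1 and 3.

open import Defs
open import Relation.Binary.PropositionalEquality
open import Level using (0ℓ)
open import Data.Nat using (ℕ; zero; suc; _+_; _<_; _>_; _≤_; _≡ᵇ_; s≤s⁻¹)
open import Data.Nat.Properties
open import Data.List using (List; []; _∷_; _++_; length)
open import Data.List.Properties using (length-++; foldr-forcesᵇ; foldr-preservesᵒ)
open import Data.List.Relation.Unary.All using (All; []; _∷_) renaming (tail to All-tail)
open import Data.List.Relation.Unary.All.Properties using (++⁻ˡ; ++⁻ʳ; All¬⇒¬Any)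
open import Data.List.Relation.Unary.Any using (here; there)
open import Data.List.Relation.Unary.AllPairs using (_∷_)
open import Data.List.Membership.Propositional using (_∈_)
open import Data.List.Membership.Propositional.Properties using (foldr-selective)
open import Data.List.Relation.Unary.Unique.Propositional using (Unique)
import Data.List.Relation.Unary.Unique.Propositional.Properties as Unique
open import Data.List.Relation.Binary.Permutation.Propositional using (↭-sym; ↭⇒↭ₛ)
open import Data.List.Relation.Binary.Permutation.Setoid.Properties (setoid ℕ) using (Unique-resp-↭)
open import Data.Maybe using (Maybe; just; nothing)
open import Data.Product using (_×_; _,_; proj₁; proj₂)
open import Data.Product.Function.NonDependent.Propositional using (_×-⇔_)
open import Data.Sum using (inj₁; inj₂)
open import Data.Unit using (⊤; tt)
open import Data.Empty using (⊥; ⊥-elim)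
open import Data.Bool using (true; false) renaming (T to IsTrue)
open import Function using (id)
open import Function.Bundles using (_⇔_; mk⇔; Equivalence)
open import Function.Properties.Equivalence using (⇔-setoid) renaming (sym to ⇔-sym; trans to ⇔-trans)
open import Function.Related.TypeIsomorphisms using (¬-cong-⇔)
open import Relation.Nullary using (¬_)
import Relation.Binary.Reasoning.Setoid as SetoidReasoning

module ⇔-Reasoning = SetoidReasoning (⇔-setoid 0ℓ)

perm-unique : ∀ {n σ} → IsPerm n σ → Unique σ
perm-unique {n} σ↭ =
  Unique-resp-↭ (↭⇒↭ₛ (↭-sym σ↭)) (Unique.map⁺ suc-injective (Unique.upTo⁺ n))

unique⇒adjacent≢ : ∀ u {x y : ℕ} v → Unique (u ++ x ∷ y ∷ v) → x ≢ y
unique⇒adjacent≢ []      v ((x≢y ∷ _) ∷ _) = x≢y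
unique⇒adjacent≢ (_ ∷ u) v (_ ∷ distinct)  = unique⇒adjacent≢ u v distinct

DescendsFrom : Maybe ℕ → ℕ → Set
DescendsFrom nothing  y = ⊥
DescendsFrom (just x) y = y < x

Resolved : Maybe ℕ → List ℕ → Set
Resolved p []          = ⊤
Resolved p (y ∷ [])    = ¬ DescendsFrom p y
Resolved p (y ∷ z ∷ w) = (DescendsFrom p y → y ≤ z) × Resolved (just y) (z ∷ w)

resolved-start : ∀ m w → Resolved nothing (m ∷ w) ⇔ Resolved (just m) w
resolved-start m []      = mk⇔ (λ _ → tt) (λ _ ())
resolved-start m (z ∷ w) = mk⇔ proj₂ (λ resolved → (λ ()) , resolved)

resolved-tail : ∀ p a w → Resolved p (a ∷ w) → Resolved (just a) w
resolved-tail p a []      _             = tt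
resolved-tail p a (b ∷ w) (_ , resolved) = resolved

resolved-forget : ∀ {m} w → All (m ≤_) w → Resolved (just m) w ⇔ Resolved nothing w
resolved-forget []          _         = mk⇔ id id
resolved-forget (y ∷ [])    (m≤y ∷ _) = mk⇔ (λ _ ()) (λ _ y<m → <⇒≱ y<m m≤y)
resolved-forget (y ∷ z ∷ w) (m≤y ∷ _) =
  mk⇔ (λ (_ , resolved) → (λ ()) , resolved)
      (λ (_ , resolved) → (λ y<m → ⊥-elim (<⇒≱ y<m m≤y)) , resolved)

-- Appending a letter m, smaller than every letter of the nonempty prefix a l,
-- followed by letters at least m: the descent into m is resolved iff r ≠ [],
-- and the last letter of the prefix is no descent bottom, since m is below it.
resolved-++-min : ∀ p a l {m} r → All (m <_) (a ∷ l) → All (m ≤_) r →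
  Resolved p (a ∷ l ++ m ∷ r) ⇔ (Resolved p (a ∷ l) × r ≢ [] × Resolved (just m) r)
resolved-++-min p a [] [] (m<a ∷ _) _ =
  mk⇔ (λ (_ , m≮a) → ⊥-elim (m≮a m<a)) (λ (_ , r≢[] , _) → ⊥-elim (r≢[] refl))
resolved-++-min p a [] (z ∷ r) (m<a ∷ _) (m≤z ∷ _) =
  mk⇔ (λ (a≤m , _ , resolved) → (λ d → <⇒≱ m<a (a≤m d)) , (λ ()) , resolved)
      (λ (a-not-bottom , _ , resolved) →
         (λ d → ⊥-elim (a-not-bottom d)) , (λ _ → m≤z) , resolved)
resolved-++-min p a (b ∷ l) r (_ ∷ l>m) r≥m =
  mk⇔ (λ (a≤b , rest) → let (pre , r≢[] , post) = Equivalence.to ih rest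
                        in (a≤b , pre) , r≢[] , post)
      (λ ((a≤b , pre) , r≢[] , post) → a≤b , Equivalence.from ih (pre , r≢[] , post))
  where
  ih : Resolved (just a) (b ∷ l ++ _ ∷ r)
         ⇔ (Resolved (just a) (b ∷ l) × r ≢ [] × Resolved (just _) r)
  ih = resolved-++-min (just a) b l r l>m r≥m

resolved-split : ∀ l {m} r → All (m <_) l → All (m ≤_) r →
  Resolved nothing (l ++ m ∷ r)
    ⇔ (¬ (l ≢ [] × r ≡ []) × Resolved nothing l × Resolved nothing r)
resolved-split [] {m} r _ r≥m =
  mk⇔ (λ resolved → (λ (l≢[] , _) → l≢[] refl) , tt , Equivalence.to tail resolved)
      (λ (_ , _ , resolved) → Equivalence.from tail resolved)
  where
  tail : Resolved nothing (m ∷ r) ⇔ Resolved nothing r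
  tail = ⇔-trans (resolved-start m r) (resolved-forget r r≥m)
resolved-split (a ∷ l) {m} r l>m r≥m =
  mk⇔ (λ resolved → let (pre , r≢[] , post) = Equivalence.to split resolved
                    in (λ (_ , r≡[]) → r≢[] r≡[]) , pre , Equivalence.to tail post)
      (λ (onlyLeft , pre , post) →
         Equivalence.from split (pre , (λ r≡[] → onlyLeft ((λ ()) , r≡[]))
                                     , Equivalence.from tail post))
  where
  split : Resolved nothing (a ∷ l ++ m ∷ r)
            ⇔ (Resolved nothing (a ∷ l) × r ≢ [] × Resolved (just m) r)
  split = resolved-++-min nothing a l r l>m r≥m
  tail : Resolved (just m) r ⇔ Resolved nothing r
  tail = resolved-forget r r≥m

noDoubleDescent-tail : ∀ {q w} → NoDoubleDescent (q ∷ w) → NoDoubleDescent w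
noDoubleDescent-tail {q} ndd (u , x , y , z , v , w≡ , x>y , y>z) =
  ndd (q ∷ u , x , y , z , v , cong (q ∷_) w≡ , x>y , y>z)

noFinalDescent-tail : ∀ {q w} → NoFinalDescent (q ∷ w) → NoFinalDescent w
noFinalDescent-tail {q} nfd u x y w≡ = nfd (q ∷ u) x y (cong (q ∷_) w≡)

patterns⇒resolved-after : ∀ q w → NoDoubleDescent (q ∷ w) → NoFinalDescent (q ∷ w) →
                          Resolved (just q) w
patterns⇒resolved-after q []          _   _   = tt
patterns⇒resolved-after q (y ∷ [])    _   nfd y<q = <⇒≱ y<q (<⇒≤ (nfd [] q y refl))
patterns⇒resolved-after q (y ∷ z ∷ w) ndd nfd =
  (λ y<q → ≮⇒≥ (λ z<y → ndd ([] , q , y , z , w , refl , y<q , z<y))) ,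
  patterns⇒resolved-after y (z ∷ w) (noDoubleDescent-tail ndd) (noFinalDescent-tail nfd)

patterns⇒resolved : ∀ w → NoDoubleDescent w → NoFinalDescent w → Resolved nothing w
patterns⇒resolved []      _   _   = tt
patterns⇒resolved (y ∷ w) ndd nfd =
  Equivalence.from (resolved-start y w) (patterns⇒resolved-after y w ndd nfd)

resolved⇒no-x>y>z : ∀ p u x y z v → Resolved p (u ++ x ∷ y ∷ z ∷ v) →
                    x > y → y > z → ⊥
resolved⇒no-x>y>z p []      x y z v (_ , (y≤z , _)) x>y y>z = <⇒≱ y>z (y≤z x>y)
resolved⇒no-x>y>z p (a ∷ u) x y z v resolved =
  resolved⇒no-x>y>z (just a) u x y z v (resolved-tail p a _ resolved)

resolved⇒noDoubleDescent : ∀ w → Resolved nothing w → NoDoubleDescent w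
resolved⇒noDoubleDescent _ resolved (u , x , y , z , v , refl , x>y , y>z) =
  resolved⇒no-x>y>z nothing u x y z v resolved x>y y>z

resolved⇒final-x<y : ∀ p u x y → Resolved p (u ++ x ∷ y ∷ []) → x ≢ y → x < y
resolved⇒final-x<y p []      x y (_ , y≮x) x≢y = ≤∧≢⇒< (≮⇒≥ y≮x) x≢y
resolved⇒final-x<y p (a ∷ u) x y resolved =
  resolved⇒final-x<y (just a) u x y (resolved-tail p a _ resolved)

resolved⇒noFinalDescent : ∀ w → Unique w → Resolved nothing w → NoFinalDescent w
resolved⇒noFinalDescent _ distinct resolved u x y refl =
  resolved⇒final-x<y nothing u x y resolved (unique⇒adjacent≢ u [] distinct)

inR⇔resolved : ∀ {n σ} → IsPerm n σ → InR n σ ⇔ Resolved nothing σ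
inR⇔resolved {σ = σ} σ↭ =
  mk⇔ (λ (_ , ndd , nfd) → patterns⇒resolved σ ndd nfd)
      (λ resolved → σ↭ , resolved⇒noDoubleDescent σ resolved
                       , resolved⇒noFinalDescent σ (perm-unique σ↭) resolved)

data SplitView (m : ℕ) (w : List ℕ) : List ℕ × List ℕ → Set where
  found   : ∀ l r → w ≡ l ++ m ∷ r → All (m ≢_) l → SplitView m w (l , r)
  missing : All (m ≢_) w → SplitView m w (w , [])

≡ᵇ-true⇒≡ : ∀ x m → (x ≡ᵇ m) ≡ true → x ≡ m
≡ᵇ-true⇒≡ x m x≡ᵇm = ≡ᵇ⇒≡ x m (subst IsTrue (sym x≡ᵇm) tt)

≡ᵇ-false⇒≢ : ∀ x m → (x ≡ᵇ m) ≡ false → m ≢ x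
≡ᵇ-false⇒≢ x m x≡ᵇm m≡x = subst IsTrue x≡ᵇm (≡⇒≡ᵇ x m (sym m≡x))

splitAt-view : ∀ m w → SplitView m w (splitAt m w)
splitAt-view m [] = missing []
splitAt-view m (x ∷ xs) with splitAt m xs | splitAt-view m xs | x ≡ᵇ m in x≡ᵇm
... | _ | _                 | true  = found [] xs (cong (_∷ xs) (≡ᵇ-true⇒≡ x m x≡ᵇm)) []
... | _ | found l r xs≡ l≢m | false =
  found (x ∷ l) r (cong (x ∷_) xs≡) (≡ᵇ-false⇒≢ x m x≡ᵇm ∷ l≢m)
... | _ | missing xs≢m      | false = missing (≡ᵇ-false⇒≢ x m x≡ᵇm ∷ xs≢m)

minLetter-∈ : ∀ x xs → minLetter x xs ∈ x ∷ xs
minLetter-∈ x xs with foldr-selective ⊓-sel x xs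
... | inj₁ min≡x  = here min≡x
... | inj₂ min∈xs = there min∈xs

minLetter-≤ : ∀ x xs → All (minLetter x xs ≤_) (x ∷ xs)
minLetter-≤ x xs = min≤x ∷ min≤xs
  where
  min≤x : minLetter x xs ≤ x
  min≤x = foldr-preservesᵒ
    (λ { a b (inj₁ a≤x) → ≤-trans (m⊓n≤m a b) a≤x
       ; a b (inj₂ b≤x) → ≤-trans (m⊓n≤n a b) b≤x })
    x xs (inj₁ ≤-refl)
  min≤xs : All (minLetter x xs ≤_) xs
  min≤xs = foldr-forcesᵇ
    (λ a b min≤a⊓b → ≤-trans min≤a⊓b (m⊓n≤m a b) , ≤-trans min≤a⊓b (m⊓n≤n a b))
    x xs ≤-refl

SplitsAround : ℕ → List ℕ → List ℕ × List ℕ → Set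
SplitsAround m w (l , r) = w ≡ l ++ m ∷ r × All (m <_) l × All (m ≤_) r

minLetter-split : ∀ x xs →
  SplitsAround (minLetter x xs) (x ∷ xs) (splitAt (minLetter x xs) (x ∷ xs))
minLetter-split x xs
  with splitAt (minLetter x xs) (x ∷ xs) | splitAt-view (minLetter x xs) (x ∷ xs)
... | _ | missing m∉w = ⊥-elim (All¬⇒¬Any {P = minLetter x xs ≡_} m∉w (minLetter-∈ x xs))
... | _ | found l r w≡ l≢m =
  w≡ , strictly-above l≢m (++⁻ˡ l above) , All-tail (++⁻ʳ l above)
  where
  above : All (minLetter x xs ≤_) (l ++ minLetter x xs ∷ r)
  above = subst (All (minLetter x xs ≤_)) w≡ (minLetter-≤ x xs)
  strictly-above : ∀ {l} → All (minLetter x xs ≢_) l → All (minLetter x xs ≤_) l →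
                   All (minLetter x xs <_) l
  strictly-above []          []          = []
  strictly-above (m≢a ∷ l≢m) (m≤a ∷ m≤l) = ≤∧≢⇒< m≤a m≢a ∷ strictly-above l≢m m≤l

parts-shorter : ∀ (l : List ℕ) m r {k} → length (l ++ m ∷ r) ≤ suc k →
                length l ≤ k × length r ≤ k
parts-shorter l m r {k} le =
  ≤-trans (m≤m+n (length l) (length r)) parts≤k ,
  ≤-trans (m≤n+m (length r) (length l)) parts≤k
  where
  parts≤k : length l + length r ≤ k
  parts≤k = s≤s⁻¹ (subst (_≤ _) (trans (length-++ l) (+-suc (length l) (length r))) le)

minTree-empty : ∀ k w → length w ≤ k → minTreeFuel k w ≡ empty ⇔ w ≡ []
minTree-empty zero    []       _  = mk⇔ (λ _ → refl) (λ _ → refl)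
minTree-empty zero    (x ∷ xs) ()
minTree-empty (suc k) []       _  = mk⇔ (λ _ → refl) (λ _ → refl)
minTree-empty (suc k) (x ∷ xs) _ with splitAt (minLetter x xs) (x ∷ xs)
... | _ = mk⇔ (λ ()) (λ ())

noOnlyLeftChild-node : ∀ {l m r} → NoOnlyLeftChild (node l m r) ⇔
  (¬ (l ≢ empty × r ≡ empty) × NoOnlyLeftChild l × NoOnlyLeftChild r)
noOnlyLeftChild-node =
  mk⇔ (λ { (node root left right) → root , left , right })
      (λ (root , left , right) → node root left right)

minTreeFuel-resolved : ∀ k w → length w ≤ k →
                       NoOnlyLeftChild (minTreeFuel k w) ⇔ Resolved nothing w
minTreeFuel-resolved zero    []       _ = mk⇔ (λ _ → tt) (λ _ → empty)
minTreeFuel-resolved zero    (x ∷ xs) ()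
minTreeFuel-resolved (suc k) []       _ = mk⇔ (λ _ → tt) (λ _ → empty)
minTreeFuel-resolved (suc k) (x ∷ xs) len≤
  with splitAt (minLetter x xs) (x ∷ xs) | minLetter-split x xs
... | (l , r) | (w≡ , l>m , r≥m) = begin
  NoOnlyLeftChild (node (minTreeFuel k l) m (minTreeFuel k r))
    ≈⟨ noOnlyLeftChild-node ⟩
  (¬ (minTreeFuel k l ≢ empty × minTreeFuel k r ≡ empty)
     × NoOnlyLeftChild (minTreeFuel k l) × NoOnlyLeftChild (minTreeFuel k r))
    ≈⟨ ¬-cong-⇔ (¬-cong-⇔ (minTree-empty k l lenˡ) ×-⇔ minTree-empty k r lenʳ)
       ×-⇔ minTreeFuel-resolved k l lenˡ ×-⇔ minTreeFuel-resolved k r lenʳ ⟩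
  (¬ (l ≢ [] × r ≡ []) × Resolved nothing l × Resolved nothing r)
    ≈⟨ resolved-split l r l>m r≥m ⟨
  Resolved nothing (l ++ m ∷ r)
    ≡⟨ cong (Resolved nothing) w≡ ⟨
  Resolved nothing (x ∷ xs) ∎
  where
  open ⇔-Reasoning
  m : ℕ
  m = minLetter x xs
  lengths : length l ≤ k × length r ≤ k
  lengths = parts-shorter l m r (subst (λ w → length w ≤ suc k) w≡ len≤)
  lenˡ : length l ≤ k
  lenˡ = proj₁ lengths
  lenʳ : length r ≤ k
  lenʳ = proj₂ lengths

minTree-resolved : ∀ w → NoOnlyLeftChild (T w) ⇔ Resolved nothing w
minTree-resolved w = minTreeFuel-resolved (length w) w ≤-refl

proposition7p4 : ∀ (n : ℕ) (σ : List ℕ) → IsPerm n σ →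
                 (InR n σ ⇔ NoOnlyLeftChild (T σ))
proposition7p4 n σ σ↭ = ⇔-trans (inR⇔resolved σ↭) (⇔-sym (minTree-resolved σ))
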